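{- Let $F$ be a graph with at least one edge. For every nonempty forest of copies $\mathscr{F}$ of $F$, the graph $\mathfrak{F}=\bigcup\mathscr{F}$ satisfies $m_2(\mathfrak{F})=m_2(F)$.
   Context: For a graph $F$ with at least one edge, $d_2(F)=\frac{|E(F)|-1}{|V(F)|-2}$ if $|V(F)|\ge 3$ and $d_2(K_2)=1$; $m_2(F)=\max\{d_2(F')\colon F'\subseteq F,\ e(F')\ge 1\}$. A forest of copies of $F$ is a set $\mathscr{F}$ of graphs isomorphic to $F$ with an enumeration $\{F_1,\dots,F_{|\mathscr{F}|}\}$ such that for each $j\ge 2$ the set $V(F_j)\cap\bigcup_{i<j}V(F_i)$ is empty, a single vertex, or an edge belonging to both $E(F_j)$ and $\bigcup_{i<j}E(F_i)$; $\bigcup\mathscr{F}$ has vertex set $\bigcup V(F_i)$ and edge set $\bigcup E(F_i)$. -}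

module Defs where

open import Data.Nat using (ℕ; zero; suc; _<_; _≤_; _∸_; _≟_)
open import Data.Integer using (+_)
open import Data.Rational using (ℚ; _/_; 1ℚ) renaming (_≤_ to _≤ℚ_)
open import Data.Product using (Σ; ∃; ∃-syntax; _×_; _,_)
open import Data.Product.Properties using (≡-dec)
open import Data.Sum using (_⊎_)
open import Data.Empty using (⊥)
open import Data.Unit using (⊤)
open import Data.List using (List; []; _∷_; _++_; length; concatMap; deduplicate)
open import Data.List.Membership.Propositional using (_∈_; _∉_)
open import Relation.Binary.PropositionalEquality using (_≡_)
open import Function.Bundles using (_⇔_)

-- An edge {u,v} is stored as the ordered pair (u , v) with u < v.
-- Repetitions in the lists are allowed; sizes are counted after deduplication.
record Graph : Set where
  constructor graph
  field
    V : List ℕ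
    E : List (ℕ × ℕ)
open Graph public

WF : Graph → Set
WF G = ∀ {u v} → (u , v) ∈ E G → (u < v) × (u ∈ V G) × (v ∈ V G)

nV : Graph → ℕ
nV G = length (deduplicate _≟_ (V G))

nE : Graph → ℕ
nE G = length (deduplicate (≡-dec _≟_ _≟_) (E G))

Adj : Graph → ℕ → ℕ → Set
Adj G u v = ((u , v) ∈ E G) ⊎ ((v , u) ∈ E G)

_≅_ : Graph → Graph → Set
G ≅ H = Σ (ℕ → ℕ) λ f →
    (∀ {u} → u ∈ V G → f u ∈ V H)
  × (∀ {w} → w ∈ V H → ∃[ u ] (u ∈ V G × f u ≡ w))
  × (∀ {u v} → u ∈ V G → v ∈ V G → f u ≡ f v → u ≡ v)
  × (∀ {u v} → u ∈ V G → v ∈ V G → Adj G u v ⇔ Adj H (f u) (f v))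

_⊆G_ : Graph → Graph → Set
G' ⊆G G = WF G'
  × (∀ {x} → x ∈ V G' → x ∈ V G)
  × (∀ {e} → e ∈ E G' → e ∈ E G)

-- d₂ : (e - 1)/(v - 2) if v ≥ 3, and 1 otherwise (i.e. for K₂)
d2' : ℕ → ℕ → ℚ
d2' e (suc (suc (suc k))) = (+ (e ∸ 1)) / (suc k)
d2' e _ = 1ℚ

d2 : Graph → ℚ
d2 G = d2' (nE G) (nV G)

IsM2 : Graph → ℚ → Set
IsM2 G q =
    (∃[ G' ] (G' ⊆G G × 1 ≤ nE G' × d2 G' ≡ q))
  × (∀ G' → G' ⊆G G → 1 ≤ nE G' → d2 G' ≤ℚ q)

⋃ : List Graph → Graph
⋃ Hs = graph (concatMap V Hs) (concatMap E Hs)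

Attach : Graph → Graph → Set
Attach P H =
    (∀ {x} → x ∈ V H → x ∉ V P)
  ⊎ (∃[ x ] (∀ y → ((y ∈ V H) × (y ∈ V P)) ⇔ (y ≡ x)))
  ⊎ (∃[ u ] ∃[ v ] ((u , v) ∈ E H × (u , v) ∈ E P
        × (∀ y → ((y ∈ V H) × (y ∈ V P)) ⇔ ((y ≡ u) ⊎ (y ≡ v)))))

ForestFrom : Graph → List Graph → List Graph → Set
ForestFrom F acc [] = ⊤
ForestFrom F acc (H ∷ Hs) =
  WF H × (H ≅ F) × Attach (⋃ acc) H × ForestFrom F (acc ++ (H ∷ [])) Hs

IsForestOfCopies : Graph → List Graph → Set
IsForestOfCopies F Hs = ForestFrom F [] Hs

{-# OPTIONS --safe #-}
module Submission where

-- Write d₂(S) ≤ q without the denominator, as e(S) − 1 ≤ q (v(S) − 2) (D2≤), and m₂(G) ≤ q as this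
-- inequality for every subgraph of G (M2≤). Since F has an edge, its K₂ subgraphs force q ≥ 1.
-- For q ≥ 1 the inequality survives gluing: for T ⊆ P ∪ H, inclusion–exclusion expresses e(T) and v(T)
-- through the parts of T in P and in H and the k vertices and j edges of T shared by P and H, and what is
-- lost, q (k − 2) + 1 − j, is ≤ 0 when k ≤ 1, or when k ≤ 2 and j ≥ 1. Attaching a copy along at most a
-- vertex or an edge guarantees this (after adding the shared edge to T when T contains both its ends).
-- Adding the copies one at a time therefore keeps m₂ ≤ q, and a subgraph of F attaining q reappears in
-- the first copy.

open import Defs
open import Level using (0ℓ)
open import Function using (_∘_)
open import Function.Bundles using (Equivalence; _⇔_)
open import Function.Construct.Symmetry using (⇔-sym)
open import Data.Product using (∃-syntax; _×_; _,_; proj₁; proj₂)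
open import Data.Product.Properties using (≡-dec; ,-injective)
open import Data.Sum using (_⊎_; inj₁; inj₂)
open import Data.Nat as ℕ using (ℕ; zero; suc; z≤n; s≤s; _≤_; _<_; _≟_; _<?_)
import Data.Nat.Properties as ℕₚ
open import Data.Integer as ℤ using ()
import Data.Integer.Properties as ℤₚ
import Data.Integer.Tactic.RingSolver as ℤ-Solver
open import Data.Rational using (ℚ; 0ℚ; 1ℚ; _+_; _*_; _-_; -_; _/_; toℚᵘ; nonNegative; positive)
  renaming (_≤_ to _≤ℚ_; _<_ to _<ℚ_)
import Data.Rational.Properties as ℚₚ
open import Data.Rational.Unnormalised using (mkℚᵘ; *≡*) renaming (_≃_ to _≃ᵘ_; _*_ to _*ᵘ_)
import Data.Rational.Unnormalised.Properties as ℚᵘₚ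
open import Tactic.RingSolver using (solve-∀)
open import Tactic.RingSolver.Core.AlmostCommutativeRing using (AlmostCommutativeRing; fromCommutativeRing)
open import Data.List using (List; []; _∷_; _++_; length; filter; map; concatMap; deduplicate)
open import Data.List.Properties using (filter-notAll; length-map; concatMap-++; ++-identityʳ; ++-assoc)
open import Data.List.Membership.Propositional using (_∈_; _∉_; find; lose)
open import Data.List.Membership.Propositional.Properties
  using (∈-filter⁺; ∈-filter⁻; ∈-deduplicate⁺; ∈-deduplicate⁻; ∈-map⁺; ∈-map⁻; ∈-++⁺ˡ; ∈-++⁺ʳ; ∈-++⁻)
open import Data.List.Relation.Binary.Subset.Propositional using (_⊆_)
import Data.List.Relation.Binary.Subset.Propositional.Properties as Subset
open import Data.List.Relation.Unary.Any as Any using (here; there; any?)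
open import Data.List.Relation.Unary.All as All using ([]; _∷_)
import Data.List.Relation.Unary.All.Properties as All
open import Data.List.Relation.Unary.AllPairs using ([]; _∷_)
open import Data.List.Relation.Unary.Unique.Propositional using (Unique)
import Data.List.Relation.Unary.Unique.Propositional.Properties as Unique
import Data.List.Relation.Unary.Unique.DecPropositional.Properties as Unique
open import Relation.Binary using (DecidableEquality; tri<; tri≈; tri>)
open import Relation.Binary.PropositionalEquality
  using (_≡_; _≢_; refl; sym; trans; cong; cong₂; subst; subst₂; module ≡-Reasoning)
open import Relation.Nullary using (¬?; yes; no; contradiction)
open import Relation.Nullary.Decidable using (dec⇒maybe)
open import Relation.Unary using (Pred; Decidable)
open import Relation.Unary.Properties using (_∩?_)

module DistinctCount {A : Set} (_≟_ : DecidableEquality A) where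

  private
    variable
      xs ys : List A

    ⊆-deduplicate : xs ⊆ deduplicate _≟_ xs
    ⊆-deduplicate = ∈-deduplicate⁺ _≟_

    deduplicate-⊆ : deduplicate _≟_ xs ⊆ xs
    deduplicate-⊆ {xs} = ∈-deduplicate⁻ _≟_ xs

  count : List A → ℕ
  count xs = length (deduplicate _≟_ xs)

  Unique-⊆⇒length≤ : Unique xs → xs ⊆ ys → length xs ≤ length ys
  Unique-⊆⇒length≤ [] _ = z≤n
  Unique-⊆⇒length≤ {x ∷ xs} {ys} (x∉xs ∷ xs!) x∷xs⊆ys = begin-strict
    length xs               ≤⟨ Unique-⊆⇒length≤ xs! xs⊆ys-x ⟩
    length (filter ≢x? ys)  <⟨ filter-notAll ≢x? ys (Any.map (λ x≡y x≢y → x≢y x≡y) (x∷xs⊆ys (here refl))) ⟩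
    length ys               ∎
    where
    open ℕₚ.≤-Reasoning
    ≢x? = λ y → ¬? (x ≟ y)
    xs⊆ys-x : xs ⊆ filter ≢x? ys
    xs⊆ys-x z∈xs = ∈-filter⁺ ≢x? (x∷xs⊆ys (there z∈xs)) (All.lookup x∉xs z∈xs)

  length≤count : Unique xs → xs ⊆ ys → length xs ≤ count ys
  length≤count xs! xs⊆ys = Unique-⊆⇒length≤ xs! (Subset.⊆-trans xs⊆ys ⊆-deduplicate)

  count≤length : xs ⊆ ys → count xs ≤ length ys
  count≤length xs⊆ys = Unique-⊆⇒length≤ (Unique.deduplicate-! _≟_ _) (Subset.⊆-trans deduplicate-⊆ xs⊆ys)

  count-mono : xs ⊆ ys → count xs ≤ count ys
  count-mono xs⊆ys = count≤length (Subset.⊆-trans xs⊆ys ⊆-deduplicate)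

  count-unique : Unique ys → xs ⊆ ys → ys ⊆ xs → count xs ≡ length ys
  count-unique ys! xs⊆ys ys⊆xs = ℕₚ.≤-antisym (count≤length xs⊆ys) (length≤count ys! ys⊆xs)

  ∈⇒1≤count : ∀ {x} → x ∈ xs → 1 ≤ count xs
  ∈⇒1≤count x∈xs = length≤count ([] ∷ []) (λ { (here refl) → x∈xs })

  1≤count⇒∈ : 1 ≤ count xs → ∃[ x ] x ∈ xs
  1≤count⇒∈ {x ∷ _} _ = x , here refl

  module _ {ℓ} {P Q : Pred A ℓ} (P? : Decidable P) (Q? : Decidable Q) where

    length-filter-∪ : ∀ xs → (∀ {x} → x ∈ xs → P x ⊎ Q x) →
      length xs ℕ.+ length (filter (P? ∩? Q?) xs) ≡ length (filter P? xs) ℕ.+ length (filter Q? xs)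
    length-filter-∪ [] _ = refl
    length-filter-∪ (x ∷ xs) covered with P? x | Q? x | length-filter-∪ xs (λ x∈ → covered (there x∈))
    ... | yes p | yes q | ih = cong suc (trans (ℕₚ.+-suc _ _) (trans (cong suc ih) (sym (ℕₚ.+-suc _ _))))
    ... | yes p | no ¬q | ih = cong suc ih
    ... | no ¬p | yes q | ih = trans (cong suc ih) (sym (ℕₚ.+-suc _ _))
    ... | no ¬p | no ¬q | _ with covered (here refl)
    ...   | inj₁ p = contradiction p ¬p
    ...   | inj₂ q = contradiction q ¬q

    count-filter-∪ : ∀ xs → (∀ {x} → x ∈ xs → P x ⊎ Q x) →
      count xs ℕ.+ count (filter (P? ∩? Q?) xs) ≡ count (filter P? xs) ℕ.+ count (filter Q? xs)
    count-filter-∪ xs covered = begin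
      count xs ℕ.+ count (filter (P? ∩? Q?) xs)
        ≡⟨ cong (count xs ℕ.+_) (count-filter (P? ∩? Q?)) ⟩
      length ds ℕ.+ length (filter (P? ∩? Q?) ds)
        ≡⟨ length-filter-∪ ds (λ x∈ → covered (deduplicate-⊆ x∈)) ⟩
      length (filter P? ds) ℕ.+ length (filter Q? ds)
        ≡⟨ sym (cong₂ ℕ._+_ (count-filter P?) (count-filter Q?)) ⟩
      count (filter P? xs) ℕ.+ count (filter Q? xs)
        ∎
      where
      open ≡-Reasoning
      ds = deduplicate _≟_ xs
      count-filter : ∀ {R : Pred A ℓ} (R? : Decidable R) → count (filter R? xs) ≡ length (filter R? ds)
      count-filter R? = count-unique (Unique.filter⁺ R? (Unique.deduplicate-! _≟_ xs))
        (λ x∈ → let x∈xs , r = ∈-filter⁻ R? {xs = xs} x∈ in ∈-filter⁺ R? (⊆-deduplicate x∈xs) r)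
        (λ x∈ → let x∈ds , r = ∈-filter⁻ R? {xs = ds} x∈ in ∈-filter⁺ R? (deduplicate-⊆ x∈ds) r)

Unique-map⁺ : ∀ {A B : Set} {f : A → B} {xs} →
  (∀ {x y} → x ∈ xs → y ∈ xs → f x ≡ f y → x ≡ y) → Unique xs → Unique (map f xs)
Unique-map⁺ f-inj [] = []
Unique-map⁺ f-inj (x∉xs ∷ xs!) =
  All.map⁺ (All.tabulate λ y∈xs fx≡fy → All.lookup x∉xs y∈xs (f-inj (here refl) (there y∈xs) fx≡fy))
  ∷ Unique-map⁺ (λ x∈ y∈ → f-inj (there x∈) (there y∈)) xs!

module _ {A B : Set} (_≟A_ : DecidableEquality A) (_≟B_ : DecidableEquality B) where
  open DistinctCount

  count-map : ∀ (f : A → B) xs → (∀ {x y} → x ∈ xs → y ∈ xs → f x ≡ f y → x ≡ y) →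
    count _≟B_ (map f xs) ≡ count _≟A_ xs
  count-map f xs f-inj = trans
    (count-unique _≟B_ (Unique-map⁺ (λ x∈ y∈ → f-inj (∈-deduplicate⁻ _≟A_ xs x∈) (∈-deduplicate⁻ _≟A_ xs y∈))
                                     (Unique.deduplicate-! _≟A_ xs))
                       (Subset.map⁺ f (∈-deduplicate⁺ _≟A_))
                       (Subset.map⁺ f (∈-deduplicate⁻ _≟A_ xs)))
    (length-map f (deduplicate _≟A_ xs))

ℚ-ring : AlmostCommutativeRing 0ℓ 0ℓ
ℚ-ring = fromCommutativeRing ℚₚ.+-*-commutativeRing (λ p → dec⇒maybe (0ℚ ℚₚ.≟ p))

fromℕ : ℕ → ℚ
fromℕ zero    = 0ℚ
fromℕ (suc n) = 1ℚ + fromℕ n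

fromℕ-+ : ∀ m n → fromℕ (m ℕ.+ n) ≡ fromℕ m + fromℕ n
fromℕ-+ zero    n = sym (ℚₚ.+-identityˡ (fromℕ n))
fromℕ-+ (suc m) n = trans (cong (1ℚ +_) (fromℕ-+ m n)) (sym (ℚₚ.+-assoc 1ℚ (fromℕ m) (fromℕ n)))

fromℕ-+-cong : ∀ a b c d → a ℕ.+ b ≡ c ℕ.+ d → fromℕ a + fromℕ b ≡ fromℕ c + fromℕ d
fromℕ-+-cong a b c d eq = trans (sym (fromℕ-+ a b)) (trans (cong fromℕ eq) (fromℕ-+ c d))

fromℕ-nonNeg : ∀ n → 0ℚ ≤ℚ fromℕ n
fromℕ-nonNeg zero    = ℚₚ.≤-refl
fromℕ-nonNeg (suc n) = ℚₚ.+-mono-≤ (ℚₚ.nonNegative⁻¹ 1ℚ) (fromℕ-nonNeg n)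

fromℕ-pos : ∀ n → 0ℚ <ℚ fromℕ (suc n)
fromℕ-pos n = ℚₚ.+-mono-<-≤ (ℚₚ.positive⁻¹ 1ℚ) (fromℕ-nonNeg n)

fromℕ-mono-≤ : ∀ {m n} → m ≤ n → fromℕ m ≤ℚ fromℕ n
fromℕ-mono-≤ {n = n} z≤n = fromℕ-nonNeg n
fromℕ-mono-≤ (s≤s m≤n)  = ℚₚ.+-monoʳ-≤ 1ℚ (fromℕ-mono-≤ m≤n)

toℚᵘ-fromℕ : ∀ n → toℚᵘ (fromℕ n) ≃ᵘ mkℚᵘ (ℤ.+ n) 0
toℚᵘ-fromℕ zero    = *≡* refl
toℚᵘ-fromℕ (suc n) = ℚᵘₚ.≃-trans (ℚₚ.toℚᵘ-homo-+ 1ℚ (fromℕ n))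
  (ℚᵘₚ.≃-trans (ℚᵘₚ.+-congʳ (toℚᵘ 1ℚ) (toℚᵘ-fromℕ n)) (*≡* (cross-multiplied (ℤ.+ n))))
  where
  cross-multiplied : ∀ m → (ℤ.+ 1 ℤ.* ℤ.+ 1 ℤ.+ m ℤ.* ℤ.+ 1) ℤ.* ℤ.+ 1 ≡ (ℤ.+ 1 ℤ.+ m) ℤ.* (ℤ.+ 1 ℤ.* ℤ.+ 1)
  cross-multiplied = ℤ-Solver.solve-∀

/suc*fromℕ : ∀ n k → (ℤ.+ n / suc k) * fromℕ (suc k) ≡ fromℕ n
/suc*fromℕ n k = ℚₚ.toℚᵘ-injective (begin
  toℚᵘ ((ℤ.+ n / suc k) * fromℕ (suc k))
    ≈⟨ ℚₚ.toℚᵘ-homo-* (ℤ.+ n / suc k) (fromℕ (suc k)) ⟩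
  toℚᵘ (ℤ.+ n / suc k) *ᵘ toℚᵘ (fromℕ (suc k))
    ≈⟨ ℚᵘₚ.*-cong (ℚₚ.toℚᵘ-fromℚᵘ (mkℚᵘ (ℤ.+ n) k)) (toℚᵘ-fromℕ (suc k)) ⟩
  mkℚᵘ (ℤ.+ n) k *ᵘ mkℚᵘ (ℤ.+ suc k) 0
    ≈⟨ *≡* (ℤₚ.*-assoc (ℤ.+ n) (ℤ.+ suc k) (ℤ.+ 1)) ⟩
  mkℚᵘ (ℤ.+ n) 0
    ≈⟨ ℚᵘₚ.≃-sym (toℚᵘ-fromℕ n) ⟩
  toℚᵘ (fromℕ n)
    ∎)
  where
  open ℚᵘₚ.≃-Reasoning

n/d≤q⇒n≤q*d : ∀ {n k q} → ℤ.+ n / suc k ≤ℚ q → fromℕ n ≤ℚ q * fromℕ (suc k)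
n/d≤q⇒n≤q*d {n} {k} {q} n/d≤q = subst (_≤ℚ q * fromℕ (suc k)) (/suc*fromℕ n k)
  (ℚₚ.*-monoʳ-≤-nonNeg (fromℕ (suc k)) {{nonNegative (fromℕ-nonNeg (suc k))}} n/d≤q)

n≤q*d⇒n/d≤q : ∀ {n k q} → fromℕ n ≤ℚ q * fromℕ (suc k) → ℤ.+ n / suc k ≤ℚ q
n≤q*d⇒n/d≤q {n} {k} {q} n≤q*d = ℚₚ.*-cancelʳ-≤-pos (fromℕ (suc k)) {{positive (fromℕ-pos k)}}
  (subst (_≤ℚ q * fromℕ (suc k)) (sym (/suc*fromℕ n k)) n≤q*d)

fromℕ-+-sub : ∀ m n → fromℕ (m ℕ.+ n) - fromℕ m ≡ fromℕ n
fromℕ-+-sub m n = trans (cong (_- fromℕ m) (fromℕ-+ m n)) (add-sub-cancel (fromℕ m) (fromℕ n))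
  where
  add-sub-cancel : ∀ a b → (a + b) - a ≡ b
  add-sub-cancel = solve-∀ ℚ-ring

data D2≤ (q : ℚ) (e v : ℕ) : Set where
  edgeless : e ≡ 0 → D2≤ q e v
  bounded  : fromℕ e - fromℕ 1 ≤ℚ q * (fromℕ v - fromℕ 2) → D2≤ q e v

data SmallOverlap (k j : ℕ) : Set where
  ≤1-vertex          : k ≤ 1 → SmallOverlap k j
  ≤2-vertices-1-edge : k ≤ 2 → 1 ≤ j → SmallOverlap k j

private
  x+y≡z⇒x≡z-y : ∀ x y {z} → x + y ≡ z → x ≡ z - y
  x+y≡z⇒x≡z-y x y refl = add-sub-cancel x y
    where
    add-sub-cancel : ∀ x y → x ≡ (x + y) - y
    add-sub-cancel = solve-∀ ℚ-ring

  p≤q⇒p-q≤0 : ∀ {p q} → p ≤ℚ q → p - q ≤ℚ 0ℚ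
  p≤q⇒p-q≤0 {p} {q} p≤q = ℚₚ.≤-trans (ℚₚ.+-monoˡ-≤ (- q) p≤q) (ℚₚ.≤-reflexive (ℚₚ.+-inverseʳ q))

module _ {q : ℚ} (1≤q : 1ℚ ≤ℚ q) where

  open ℚₚ.≤-Reasoning

  private
    0≤q : 0ℚ ≤ℚ q
    0≤q = ℚₚ.≤-trans (ℚₚ.nonNegative⁻¹ 1ℚ) 1≤q

  *[-2]-mono-≤ : ∀ {m n} → m ≤ n → q * (fromℕ m - fromℕ 2) ≤ℚ q * (fromℕ n - fromℕ 2)
  *[-2]-mono-≤ m≤n = ℚₚ.*-monoˡ-≤-nonNeg q {{nonNegative 0≤q}} (ℚₚ.+-monoˡ-≤ (- fromℕ 2) (fromℕ-mono-≤ m≤n))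

  D2≤-mono : ∀ {e e′ v v′} → D2≤ q e′ v′ → e ≤ e′ → v′ ≤ v → D2≤ q e v
  D2≤-mono (edgeless refl) z≤n _ = edgeless refl
  D2≤-mono {e} {e′} {v} {v′} (bounded bound) e≤e′ v′≤v = bounded (begin
    fromℕ e - fromℕ 1        ≤⟨ ℚₚ.+-monoˡ-≤ (- fromℕ 1) (fromℕ-mono-≤ e≤e′) ⟩
    fromℕ e′ - fromℕ 1       ≤⟨ bound ⟩
    q * (fromℕ v′ - fromℕ 2) ≤⟨ *[-2]-mono-≤ v′≤v ⟩
    q * (fromℕ v - fromℕ 2)  ∎)

  SmallOverlap⇒≤ : ∀ {k j} → SmallOverlap k j → q * (fromℕ k - fromℕ 2) + fromℕ 1 ≤ℚ fromℕ j
  SmallOverlap⇒≤ {k} {j} (≤1-vertex k≤1) = begin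
    q * (fromℕ k - fromℕ 2) + fromℕ 1  ≤⟨ ℚₚ.+-monoˡ-≤ (fromℕ 1) (*[-2]-mono-≤ k≤1) ⟩
    q * (fromℕ 1 - fromℕ 2) + fromℕ 1  ≡⟨ at-k≡1 q ⟩
    1ℚ - q                             ≤⟨ p≤q⇒p-q≤0 1≤q ⟩
    0ℚ                                 ≤⟨ fromℕ-nonNeg j ⟩
    fromℕ j                            ∎
    where
    at-k≡1 : ∀ p → p * (fromℕ 1 - fromℕ 2) + fromℕ 1 ≡ 1ℚ - p
    at-k≡1 = solve-∀ ℚ-ring
  SmallOverlap⇒≤ {k} {j} (≤2-vertices-1-edge k≤2 1≤j) = begin
    q * (fromℕ k - fromℕ 2) + fromℕ 1  ≤⟨ ℚₚ.+-monoˡ-≤ (fromℕ 1) (*[-2]-mono-≤ k≤2) ⟩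
    q * (fromℕ 2 - fromℕ 2) + fromℕ 1  ≡⟨ at-k≡2 q ⟩
    fromℕ 1                            ≤⟨ fromℕ-mono-≤ 1≤j ⟩
    fromℕ j                            ∎
    where
    at-k≡2 : ∀ p → p * (fromℕ 2 - fromℕ 2) + fromℕ 1 ≡ fromℕ 1
    at-k≡2 = solve-∀ ℚ-ring

  D2≤-glue : ∀ {e j eA eB v k vA vB} → D2≤ q eA vA → D2≤ q eB vB → vA ≤ v → vB ≤ v →
    e ℕ.+ j ≡ eA ℕ.+ eB → v ℕ.+ k ≡ vA ℕ.+ vB → SmallOverlap k j → D2≤ q e v
  D2≤-glue {e} {j} (edgeless refl) boundB _ vB≤v e+j≡ _ _ =
    D2≤-mono boundB (subst (e ≤_) e+j≡ (ℕₚ.m≤m+n e j)) vB≤v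
  D2≤-glue {e} {j} {eA} (bounded boundA) (edgeless refl) vA≤v _ e+j≡ _ _ =
    D2≤-mono (bounded boundA) (subst (e ≤_) (trans e+j≡ (ℕₚ.+-identityʳ eA)) (ℕₚ.m≤m+n e j)) vA≤v
  D2≤-glue {e} {j} {eA} {eB} {v} {k} {vA} {vB} (bounded boundA) (bounded boundB) _ _ e+j≡ v+k≡ small =
    bounded (begin
      fromℕ e - fromℕ 1
        ≡⟨ cong (_- fromℕ 1) e≡ ⟩
      (fromℕ eA + fromℕ eB) - fromℕ j - fromℕ 1
        ≡⟨ regroupₑ (fromℕ eA) (fromℕ eB) (fromℕ j) ⟩
      (fromℕ eA - fromℕ 1) + (fromℕ eB - fromℕ 1) + (fromℕ 1 - fromℕ j)
        ≤⟨ ℚₚ.+-monoˡ-≤ (fromℕ 1 - fromℕ j) (ℚₚ.+-mono-≤ boundA boundB) ⟩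
      q * (fromℕ vA - fromℕ 2) + q * (fromℕ vB - fromℕ 2) + (fromℕ 1 - fromℕ j)
        ≡⟨ regroupᵥ q (fromℕ vA) (fromℕ vB) (fromℕ k) (fromℕ j) ⟩
      q * ((fromℕ vA + fromℕ vB) - fromℕ k - fromℕ 2) + (sharedTerm - fromℕ j)
        ≡⟨ cong (λ x → q * (x - fromℕ 2) + (sharedTerm - fromℕ j)) (sym v≡) ⟩
      q * (fromℕ v - fromℕ 2) + (sharedTerm - fromℕ j)
        ≤⟨ ℚₚ.+-monoʳ-≤ (q * (fromℕ v - fromℕ 2)) (p≤q⇒p-q≤0 (SmallOverlap⇒≤ small)) ⟩
      q * (fromℕ v - fromℕ 2) + 0ℚ
        ≡⟨ ℚₚ.+-identityʳ _ ⟩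
      q * (fromℕ v - fromℕ 2)
        ∎)
    where
    sharedTerm = q * (fromℕ k - fromℕ 2) + fromℕ 1
    e≡ : fromℕ e ≡ (fromℕ eA + fromℕ eB) - fromℕ j
    e≡ = x+y≡z⇒x≡z-y (fromℕ e) (fromℕ j) (fromℕ-+-cong e j eA eB e+j≡)
    v≡ : fromℕ v ≡ (fromℕ vA + fromℕ vB) - fromℕ k
    v≡ = x+y≡z⇒x≡z-y (fromℕ v) (fromℕ k) (fromℕ-+-cong v k vA vB v+k≡)
    regroupₑ : ∀ x y z → (x + y) - z - fromℕ 1 ≡ (x - fromℕ 1) + (y - fromℕ 1) + (fromℕ 1 - z)
    regroupₑ = solve-∀ ℚ-ring
    regroupᵥ : ∀ p x y z w → p * (x - fromℕ 2) + p * (y - fromℕ 2) + (fromℕ 1 - w)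
                           ≡ p * ((x + y) - z - fromℕ 2) + (p * (z - fromℕ 2) + fromℕ 1 - w)
    regroupᵥ = solve-∀ ℚ-ring

  d2'≤⇒D2≤ : ∀ {e v} → 1 ≤ e → 2 ≤ v → (v ≤ 2 → e ≤ 1) → d2' e v ≤ℚ q → D2≤ q e v
  d2'≤⇒D2≤ {v = 1} _ (s≤s ()) _ _
  d2'≤⇒D2≤ {suc e} {2} _ _ e≤1 _ with e≤1 ℕₚ.≤-refl
  ... | s≤s z≤n = bounded (ℚₚ.≤-reflexive (both-zero q))
    where
    both-zero : ∀ p → fromℕ 1 - fromℕ 1 ≡ p * (fromℕ 2 - fromℕ 2)
    both-zero = solve-∀ ℚ-ring
  d2'≤⇒D2≤ {suc e} {suc (suc (suc k))} _ _ _ d2≤q = bounded (begin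
    fromℕ (suc e) - fromℕ 1              ≡⟨ fromℕ-+-sub 1 e ⟩
    fromℕ e                              ≤⟨ n/d≤q⇒n≤q*d {e} {k} d2≤q ⟩
    q * fromℕ (suc k)                    ≡⟨ cong (q *_) (fromℕ-+-sub 2 (suc k)) ⟨
    q * (fromℕ (3 ℕ.+ k) - fromℕ 2)      ∎)

  D2≤⇒d2'≤ : ∀ {e v} → 1 ≤ e → D2≤ q e v → d2' e v ≤ℚ q
  D2≤⇒d2'≤ {v = 0} _ _ = 1≤q
  D2≤⇒d2'≤ {v = 1} _ _ = 1≤q
  D2≤⇒d2'≤ {v = 2} _ _ = 1≤q
  D2≤⇒d2'≤ {suc e} {suc (suc (suc k))} _ (bounded bound) = n≤q*d⇒n/d≤q {e} {k} (begin
    fromℕ e                              ≡⟨ fromℕ-+-sub 1 e ⟨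
    fromℕ (suc e) - fromℕ 1              ≤⟨ bound ⟩
    q * (fromℕ (3 ℕ.+ k) - fromℕ 2)      ≡⟨ cong (q *_) (fromℕ-+-sub 2 (suc k)) ⟩
    q * fromℕ (suc k)                    ∎)

_≟ₑ_ : DecidableEquality (ℕ × ℕ)
_≟ₑ_ = ≡-dec _≟_ _≟_

-- With these deciders nV G and nE G are definitionally Vertices.count (V G) and Edges.count (E G).
module Vertices = DistinctCount _≟_
module Edges    = DistinctCount _≟ₑ_

open import Data.List.Membership.DecPropositional _≟_ using (_∈?_)
open import Data.List.Membership.DecPropositional _≟ₑ_ using () renaming (_∈?_ to _∈ₑ?_)

sortPair : ℕ → ℕ → ℕ × ℕ
sortPair x y with x <? y
... | yes _ = x , y
... | no  _ = y , x

sortPair-< : ∀ {x y} → x < y → sortPair x y ≡ (x , y)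
sortPair-< {x} {y} x<y with x <? y
... | yes _  = refl
... | no x≮y = contradiction x<y x≮y

sortPair-> : ∀ {x y} → y < x → sortPair x y ≡ (y , x)
sortPair-> {x} {y} y<x with x <? y
... | yes x<y = contradiction y<x (ℕₚ.<-asym x<y)
... | no  _   = refl

sortPair-cases : ∀ x y → sortPair x y ≡ (x , y) ⊎ sortPair x y ≡ (y , x)
sortPair-cases x y with x <? y
... | yes _ = inj₁ refl
... | no  _ = inj₂ refl

sortPair-injective : ∀ {x y x′ y′} → sortPair x y ≡ sortPair x′ y′ →
                     (x ≡ x′ × y ≡ y′) ⊎ (x ≡ y′ × y ≡ x′)
sortPair-injective {x} {y} {x′} {y′} eq with sortPair-cases x y | sortPair-cases x′ y′
... | inj₁ p | inj₁ p′ = inj₁ (,-injective (trans (sym p) (trans eq p′)))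
... | inj₁ p | inj₂ p′ = inj₂ (,-injective (trans (sym p) (trans eq p′)))
... | inj₂ p | inj₁ p′ = let y≡x′ , x≡y′ = ,-injective (trans (sym p) (trans eq p′)) in inj₂ (x≡y′ , y≡x′)
... | inj₂ p | inj₂ p′ = let y≡y′ , x≡x′ = ,-injective (trans (sym p) (trans eq p′)) in inj₁ (x≡x′ , y≡y′)

sortPair-∈ : ∀ {G x y} → WF G → Adj G x y → sortPair x y ∈ E G
sortPair-∈ {G} wf (inj₁ xy∈) = subst (_∈ E G) (sym (sortPair-< (proj₁ (wf xy∈)))) xy∈
sortPair-∈ {G} wf (inj₂ yx∈) = subst (_∈ E G) (sym (sortPair-> (proj₁ (wf yx∈)))) yx∈

record Embedding (G H : Graph) : Set where
  field
    to           : ℕ → ℕ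
    to-∈         : ∀ {u} → u ∈ V G → to u ∈ V H
    to-injective : ∀ {u v} → u ∈ V G → v ∈ V G → to u ≡ to v → u ≡ v
    to-Adj       : ∀ {u v} → u ∈ V G → v ∈ V G → Adj G u v → Adj H (to u) (to v)

≅⇒Embedding : ∀ {G H} → G ≅ H → Embedding G H
≅⇒Embedding (f , f-∈ , _ , f-injective , f-Adj) = record
  { to = f ; to-∈ = f-∈ ; to-injective = f-injective ; to-Adj = λ u∈ v∈ → Equivalence.to (f-Adj u∈ v∈) }

preimage : (ℕ → ℕ) → List ℕ → ℕ → ℕ
preimage f us w with any? (λ u → f u ≟ w) us
... | yes found = proj₁ (find found)
... | no  _     = w  -- junk: w has no preimage in us

preimage-spec : ∀ f us {w} → ∃[ u ] (u ∈ us × f u ≡ w) → preimage f us w ∈ us × f (preimage f us w) ≡ w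
preimage-spec f us {w} (u , u∈us , fu≡w) with any? (λ u → f u ≟ w) us
... | yes found = proj₂ (find found)
... | no  none  = contradiction (lose u∈us fu≡w) none

≅-sym : ∀ {G H} → G ≅ H → H ≅ G
≅-sym {G} {H} (f , f-∈ , f-onto , f-injective , f-Adj) = g , g-∈ , g-onto , g-injective , g-Adj
  where
  g = preimage f (V G)
  g-spec : ∀ {w} → w ∈ V H → g w ∈ V G × f (g w) ≡ w
  g-spec w∈ = preimage-spec f (V G) (f-onto w∈)
  g-∈ : ∀ {w} → w ∈ V H → g w ∈ V G
  g-∈ w∈ = proj₁ (g-spec w∈)
  f∘g : ∀ {w} → w ∈ V H → f (g w) ≡ w
  f∘g w∈ = proj₂ (g-spec w∈)
  g-onto : ∀ {u} → u ∈ V G → ∃[ w ] (w ∈ V H × g w ≡ u)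
  g-onto u∈ = f _ , f-∈ u∈ , f-injective (g-∈ (f-∈ u∈)) u∈ (f∘g (f-∈ u∈))
  g-injective : ∀ {w x} → w ∈ V H → x ∈ V H → g w ≡ g x → w ≡ x
  g-injective w∈ x∈ gw≡gx = trans (sym (f∘g w∈)) (trans (cong f gw≡gx) (f∘g x∈))
  g-Adj : ∀ {w x} → w ∈ V H → x ∈ V H → Adj H w x ⇔ Adj G (g w) (g x)
  g-Adj {w} {x} w∈ x∈ = ⇔-sym (subst₂ (λ a b → Adj G (g w) (g x) ⇔ Adj H a b) (f∘g w∈) (f∘g x∈)
                                       (f-Adj (g-∈ w∈) (g-∈ x∈)))

module _ {G H : Graph} (φ : Embedding G H) where
  open Embedding φ

  mapEdge : ℕ × ℕ → ℕ × ℕ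
  mapEdge (a , b) = sortPair (to a) (to b)

  image : Graph → Graph
  image S = graph (map to (V S)) (map mapEdge (E S))

  module _ {S : Graph} (S⊆G : S ⊆G G) where
    private
      wfS  = proj₁ S⊆G
      VS⊆ = proj₁ (proj₂ S⊆G)
      ES⊆ = proj₂ (proj₂ S⊆G)

    image-⊆G : WF H → image S ⊆G H
    image-⊆G wfH = wf-image , V-image⊆ , E-image⊆
      where
      wf-image : WF (image S)
      wf-image e∈ with ∈-map⁻ mapEdge e∈
      ... | (a , b) , ab∈ , refl with wfS ab∈
      ... | a<b , a∈ , b∈ with ℕₚ.<-cmp (to a) (to b)
      ... | tri< ta<tb _ _ rewrite sortPair-< ta<tb = ta<tb , ∈-map⁺ to a∈ , ∈-map⁺ to b∈
      ... | tri≈ _ ta≡tb _ = contradiction (to-injective (VS⊆ a∈) (VS⊆ b∈) ta≡tb) (ℕₚ.<⇒≢ a<b)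
      ... | tri> _ _ tb<ta rewrite sortPair-> tb<ta = tb<ta , ∈-map⁺ to b∈ , ∈-map⁺ to a∈
      V-image⊆ : ∀ {x} → x ∈ V (image S) → x ∈ V H
      V-image⊆ x∈ with ∈-map⁻ to x∈
      ... | a , a∈ , refl = to-∈ (VS⊆ a∈)
      E-image⊆ : ∀ {e} → e ∈ E (image S) → e ∈ E H
      E-image⊆ e∈ with ∈-map⁻ mapEdge e∈
      ... | (a , b) , ab∈ , refl with wfS ab∈
      ... | _ , a∈ , b∈ = sortPair-∈ wfH (to-Adj (VS⊆ a∈) (VS⊆ b∈) (inj₁ (ES⊆ ab∈)))

    nV-image : nV (image S) ≡ nV S
    nV-image = count-map _≟_ _≟_ to (V S) (λ a∈ b∈ → to-injective (VS⊆ a∈) (VS⊆ b∈))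

    nE-image : nE (image S) ≡ nE S
    nE-image = count-map _≟ₑ_ _≟ₑ_ mapEdge (E S) mapEdge-injective
      where
      mapEdge-injective : ∀ {e e′} → e ∈ E S → e′ ∈ E S → mapEdge e ≡ mapEdge e′ → e ≡ e′
      mapEdge-injective {a , b} {c , d} ab∈ cd∈ eq with wfS ab∈ | wfS cd∈
      ... | a<b , a∈ , b∈ | c<d , c∈ , d∈ with sortPair-injective eq
      ... | inj₁ (ta≡tc , tb≡td) =
        cong₂ _,_ (to-injective (VS⊆ a∈) (VS⊆ c∈) ta≡tc) (to-injective (VS⊆ b∈) (VS⊆ d∈) tb≡td)
      ... | inj₂ (ta≡td , tb≡tc) with to-injective (VS⊆ a∈) (VS⊆ d∈) ta≡td | to-injective (VS⊆ b∈) (VS⊆ c∈) tb≡tc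
      ...   | refl | refl = contradiction c<d (ℕₚ.<-asym a<b)

infixl 25 _∪G_ _∩G_

_∪G_ : Graph → Graph → Graph
G ∪G H = graph (V G ++ V H) (E G ++ E H)

_∩G_ : Graph → Graph → Graph
T ∩G G = graph (filter (_∈? V G) (V T)) (filter (_∈ₑ? E G) (E T))

WF-∪G : ∀ {G H} → WF G → WF H → WF (G ∪G H)
WF-∪G {G} {H} wfG wfH uv∈ with ∈-++⁻ (E G) uv∈
... | inj₁ uv∈G = let u<v , u∈ , v∈ = wfG uv∈G in u<v , ∈-++⁺ˡ u∈ , ∈-++⁺ˡ v∈
... | inj₂ uv∈H = let u<v , u∈ , v∈ = wfH uv∈H in u<v , ∈-++⁺ʳ (V G) u∈ , ∈-++⁺ʳ (V G) v∈

∩G-⊆G : ∀ {T G} → WF T → WF G → (T ∩G G) ⊆G G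
∩G-⊆G {T} {G} wfT wfG = wf , (λ x∈ → proj₂ (∈-filter⁻ (_∈? V G) {xs = V T} x∈))
                            , (λ e∈ → proj₂ (∈-filter⁻ (_∈ₑ? E G) {xs = E T} e∈))
  where
  wf : WF (T ∩G G)
  wf uv∈ with ∈-filter⁻ (_∈ₑ? E G) {xs = E T} uv∈
  ... | uv∈T , uv∈G with wfT uv∈T | wfG uv∈G
  ... | u<v , u∈T , v∈T | _ , u∈G , v∈G = u<v , ∈-filter⁺ (_∈? V G) u∈T u∈G , ∈-filter⁺ (_∈? V G) v∈T v∈G

nV-∩G≤ : ∀ T G → nV (T ∩G G) ≤ nV T
nV-∩G≤ T G = Vertices.count-mono (λ x∈ → proj₁ (∈-filter⁻ (_∈? V G) {xs = V T} x∈))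

⋃-∷ʳ : ∀ Gs G → ⋃ (Gs ++ G ∷ []) ≡ ⋃ Gs ∪G G
⋃-∷ʳ Gs G = cong₂ graph (concatMap-∷ʳ V) (concatMap-∷ʳ E)
  where
  concatMap-∷ʳ : ∀ {A : Set} (f : Graph → List A) → concatMap f (Gs ++ G ∷ []) ≡ concatMap f Gs ++ f G
  concatMap-∷ʳ f = trans (concatMap-++ f Gs (G ∷ [])) (cong (concatMap f Gs ++_) (++-identityʳ (f G)))

edge⇒2≤nV : ∀ {S a b} → WF S → (a , b) ∈ E S → 2 ≤ nV S
edge⇒2≤nV wf ab∈ with wf ab∈
... | a<b , a∈ , b∈ =
  Vertices.length≤count ((ℕₚ.<⇒≢ a<b ∷ []) ∷ [] ∷ []) λ { (here refl) → a∈ ; (there (here refl)) → b∈ }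

increasing-pair-within : ∀ {a b c d} → a < b → c < d → c ∈ a ∷ b ∷ [] → d ∈ a ∷ b ∷ [] → (c , d) ≡ (a , b)
increasing-pair-within _   c<d (here refl)         (here refl)         = contradiction c<d (ℕₚ.<-irrefl refl)
increasing-pair-within _   _   (here refl)         (there (here refl)) = refl
increasing-pair-within a<b c<d (there (here refl)) (here refl)         = contradiction c<d (ℕₚ.<-asym a<b)
increasing-pair-within _   c<d (there (here refl)) (there (here refl)) = contradiction c<d (ℕₚ.<-irrefl refl)

nV≤2⇒nE≤1 : ∀ {S} → WF S → nV S ≤ 2 → nE S ≤ 1
nV≤2⇒nE≤1 {graph _ []}              _  _     = z≤n
nV≤2⇒nE≤1 {S@(graph _ (ab ∷ _))} wf nV≤2 = Edges.count≤length {ys = ab ∷ []} (λ cd∈ → here (only-edge (here refl) cd∈))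
  where
  three-vertices : ∀ {a b x} → a < b → a ∈ V S → b ∈ V S → x ∈ V S → x ∉ a ∷ b ∷ [] → 2 < nV S
  three-vertices a<b a∈ b∈ x∈ x∉ab = Vertices.length≤count
    ((ℕₚ.<⇒≢ a<b ∷ (λ a≡x → x∉ab (here (sym a≡x))) ∷ [])
     ∷ ((λ b≡x → x∉ab (there (here (sym b≡x)))) ∷ [])
     ∷ [] ∷ [])
    (λ { (here refl) → a∈ ; (there (here refl)) → b∈ ; (there (there (here refl))) → x∈ })
  only-edge : ∀ {a b c d} → (a , b) ∈ E S → (c , d) ∈ E S → (c , d) ≡ (a , b)
  only-edge {a} {b} {c} {d} ab∈ cd∈ with wf ab∈ | wf cd∈
  ... | a<b , a∈ , b∈ | c<d , c∈ , d∈ with c ∈? a ∷ b ∷ [] | d ∈? a ∷ b ∷ []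
  ... | yes c∈ab | yes d∈ab = increasing-pair-within a<b c<d c∈ab d∈ab
  ... | no c∉ab  | _        = contradiction nV≤2 (ℕₚ.<⇒≱ (three-vertices a<b a∈ b∈ c∈ c∉ab))
  ... | _        | no d∉ab  = contradiction nV≤2 (ℕₚ.<⇒≱ (three-vertices a<b a∈ b∈ d∈ d∉ab))

M2≤ : ℚ → Graph → Set
M2≤ q G = ∀ S → S ⊆G G → D2≤ q (nE S) (nV S)

D2Bounded : Graph → ℚ → Set
D2Bounded G q = ∀ S → S ⊆G G → 1 ≤ nE S → d2 S ≤ℚ q

D2Attained : Graph → ℚ → Set
D2Attained G q = ∃[ S ] (S ⊆G G × 1 ≤ nE S × d2 S ≡ q)

module _ {q : ℚ} (1≤q : 1ℚ ≤ℚ q) where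

  D2Bounded⇒M2≤ : ∀ {G} → D2Bounded G q → M2≤ q G
  D2Bounded⇒M2≤ d2-bound S S⊆G@(wfS , _) with nE S ≟ 0
  ... | yes eS≡0 = edgeless eS≡0
  ... | no  eS≢0 =
    d2'≤⇒D2≤ 1≤q 1≤eS (edge⇒2≤nV wfS (proj₂ (Edges.1≤count⇒∈ 1≤eS))) (nV≤2⇒nE≤1 wfS) (d2-bound S S⊆G 1≤eS)
    where
    1≤eS = ℕₚ.n≢0⇒n>0 eS≢0

  M2≤⇒D2Bounded : ∀ {G} → M2≤ q G → D2Bounded G q
  M2≤⇒D2Bounded m2≤ S S⊆G 1≤eS = D2≤⇒d2'≤ 1≤q 1≤eS (m2≤ S S⊆G)

IsM2⇒1≤ : ∀ {F q} → WF F → 1 ≤ nE F → IsM2 F q → 1ℚ ≤ℚ q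
IsM2⇒1≤ {F} {q} wfF 1≤eF (_ , d2-bound) with Edges.1≤count⇒∈ 1≤eF
... | (a , b) , ab∈ with wfF ab∈
... | a<b , a∈ , b∈ = subst (_≤ℚ q) (cong (d2' 1) nV-K₂) (d2-bound K₂ (wf-K₂ , V-K₂⊆ , E-K₂⊆) (s≤s z≤n))
  where
  K₂ = graph (a ∷ b ∷ []) ((a , b) ∷ [])
  wf-K₂ : WF K₂
  wf-K₂ (here refl) = a<b , here refl , there (here refl)
  V-K₂⊆ : ∀ {x} → x ∈ V K₂ → x ∈ V F
  V-K₂⊆ (here refl)         = a∈
  V-K₂⊆ (there (here refl)) = b∈
  E-K₂⊆ : ∀ {e} → e ∈ E K₂ → e ∈ E F
  E-K₂⊆ (here refl) = ab∈
  nV-K₂ : nV K₂ ≡ 2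
  nV-K₂ = Vertices.count-unique ((ℕₚ.<⇒≢ a<b ∷ []) ∷ [] ∷ []) (λ x∈ → x∈) (λ x∈ → x∈)

module _ {G H : Graph} (wfH : WF H) (φ : Embedding G H) where

  M2≤-embedding : ∀ {q} → M2≤ q H → M2≤ q G
  M2≤-embedding {q} m2≤H S S⊆G =
    subst₂ (D2≤ q) (nE-image φ S⊆G) (nV-image φ S⊆G) (m2≤H (image φ S) (image-⊆G φ S⊆G wfH))

  D2Attained-embedding : ∀ {q} → D2Attained G q → D2Attained H q
  D2Attained-embedding (S , S⊆G , 1≤eS , d2S≡q) =
    image φ S , image-⊆G φ S⊆G wfH , subst (1 ≤_) (sym (nE-image φ S⊆G)) 1≤eS ,
    trans (cong₂ d2' (nE-image φ S⊆G) (nV-image φ S⊆G)) d2S≡q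

module Gluing {P H : Graph} (wfP : WF P) (wfH : WF H) where

  sharedV : Graph → ℕ
  sharedV T = Vertices.count (filter ((_∈? V P) ∩? (_∈? V H)) (V T))

  sharedE : Graph → ℕ
  sharedE T = Edges.count (filter ((_∈ₑ? E P) ∩? (_∈ₑ? E H)) (E T))

  sharedV≤ : ∀ T ys → (∀ {y} → y ∈ V T → y ∈ V H → y ∈ V P → y ∈ ys) → sharedV T ≤ length ys
  sharedV≤ T ys shared⊆ys = Vertices.count≤length λ y∈ →
    let y∈T , y∈P , y∈H = ∈-filter⁻ ((_∈? V P) ∩? (_∈? V H)) {xs = V T} y∈ in shared⊆ys y∈T y∈H y∈P

  M2≤-∪G-small : ∀ {q T} → 1ℚ ≤ℚ q → M2≤ q P → M2≤ q H → T ⊆G P ∪G H →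
    SmallOverlap (sharedV T) (sharedE T) → D2≤ q (nE T) (nV T)
  M2≤-∪G-small {T = T} 1≤q m2≤P m2≤H (wfT , VT⊆ , ET⊆) small =
    D2≤-glue 1≤q (m2≤P (T ∩G P) (∩G-⊆G wfT wfP)) (m2≤H (T ∩G H) (∩G-⊆G wfT wfH))
      (nV-∩G≤ T P) (nV-∩G≤ T H)
      (Edges.count-filter-∪ (_∈ₑ? E P) (_∈ₑ? E H) (E T) (λ e∈ → ∈-++⁻ (E P) (ET⊆ e∈)))
      (Vertices.count-filter-∪ (_∈? V P) (_∈? V H) (V T) (λ x∈ → ∈-++⁻ (V P) (VT⊆ x∈)))
      small

  Attach⇒SmallOverlap : ∀ {T} → Attach P H → T ⊆G P ∪G H →
    ∃[ T′ ] (T′ ⊆G P ∪G H × nE T ≤ nE T′ × nV T′ ≡ nV T × SmallOverlap (sharedV T′) (sharedE T′))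
  Attach⇒SmallOverlap {T} (inj₁ disjoint) T⊆ =
    T , T⊆ , ℕₚ.≤-refl , refl ,
    ≤1-vertex (ℕₚ.≤-trans (sharedV≤ T [] λ _ y∈H y∈P → contradiction y∈P (disjoint y∈H)) z≤n)
  Attach⇒SmallOverlap {T} (inj₂ (inj₁ (x , shared⇔x))) T⊆ =
    T , T⊆ , ℕₚ.≤-refl , refl ,
    ≤1-vertex (sharedV≤ T (x ∷ []) λ _ y∈H y∈P → here (Equivalence.to (shared⇔x _) (y∈H , y∈P)))
  Attach⇒SmallOverlap {T} (inj₂ (inj₂ (u , v , uv∈H , uv∈P , shared⇔uv))) T⊆@(wfT , VT⊆ , ET⊆)
    with u ∈? V T | v ∈? V T
  -- T contains both ends of the shared edge: adding it to T keeps v(T) and makes the overlap contain an edge.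
  ... | yes u∈T | yes v∈T = T⁺ , (wf-T⁺ , VT⊆ , ET⁺⊆) , Edges.count-mono {xs = E T} there , refl ,
                            ≤2-vertices-1-edge (sharedV≤ T (u ∷ v ∷ []) (λ _ y∈H y∈P → uv-shared y∈H y∈P))
                                  (Edges.∈⇒1≤count (∈-filter⁺ ((_∈ₑ? E P) ∩? (_∈ₑ? E H)) (here refl) (uv∈P , uv∈H)))
    where
    T⁺ = graph (V T) ((u , v) ∷ E T)
    wf-T⁺ : WF T⁺
    wf-T⁺ (here refl) = proj₁ (wfH uv∈H) , u∈T , v∈T
    wf-T⁺ (there e∈)  = wfT e∈
    ET⁺⊆ : ∀ {e} → e ∈ E T⁺ → e ∈ E (P ∪G H)
    ET⁺⊆ (here refl) = ∈-++⁺ˡ uv∈P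
    ET⁺⊆ (there e∈)  = ET⊆ e∈
    uv-shared : ∀ {y} → y ∈ V H → y ∈ V P → y ∈ u ∷ v ∷ []
    uv-shared y∈H y∈P with Equivalence.to (shared⇔uv _) (y∈H , y∈P)
    ... | inj₁ refl = here refl
    ... | inj₂ refl = there (here refl)
  ... | no u∉T | _ = T , T⊆ , ℕₚ.≤-refl , refl , ≤1-vertex (sharedV≤ T (v ∷ []) only-v)
    where
    only-v : ∀ {y} → y ∈ V T → y ∈ V H → y ∈ V P → y ∈ v ∷ []
    only-v y∈T y∈H y∈P with Equivalence.to (shared⇔uv _) (y∈H , y∈P)
    ... | inj₁ refl = contradiction y∈T u∉T
    ... | inj₂ refl = here refl
  ... | _ | no v∉T = T , T⊆ , ℕₚ.≤-refl , refl , ≤1-vertex (sharedV≤ T (u ∷ []) only-u)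
    where
    only-u : ∀ {y} → y ∈ V T → y ∈ V H → y ∈ V P → y ∈ u ∷ []
    only-u y∈T y∈H y∈P with Equivalence.to (shared⇔uv _) (y∈H , y∈P)
    ... | inj₁ refl = here refl
    ... | inj₂ refl = contradiction y∈T v∉T

  M2≤-∪G : ∀ {q} → 1ℚ ≤ℚ q → Attach P H → M2≤ q P → M2≤ q H → M2≤ q (P ∪G H)
  M2≤-∪G 1≤q attach m2≤P m2≤H T T⊆ =
    let T′ , T′⊆ , eT≤eT′ , vT′≡vT , small = Attach⇒SmallOverlap attach T⊆
    in D2≤-mono 1≤q (M2≤-∪G-small 1≤q m2≤P m2≤H T′⊆ small) eT≤eT′ (ℕₚ.≤-reflexive vT′≡vT)

M2≤-empty : ∀ {q} → M2≤ q (graph [] [])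
M2≤-empty S (_ , _ , ES⊆) = edgeless (ℕₚ.n≤0⇒n≡0 (Edges.count≤length {ys = []} ES⊆))

D2Attained-mono : ∀ {G G′ q} → V G ⊆ V G′ → E G ⊆ E G′ → D2Attained G q → D2Attained G′ q
D2Attained-mono VG⊆ EG⊆ (S , (wfS , VS⊆ , ES⊆) , 1≤eS , d2S≡q) =
  S , (wfS , VG⊆ ∘ VS⊆ , EG⊆ ∘ ES⊆) , 1≤eS , d2S≡q

module _ {F : Graph} {q : ℚ} (1≤q : 1ℚ ≤ℚ q) (wfF : WF F) (m2≤F : M2≤ q F) where

  WF×M2≤ : Graph → Set
  WF×M2≤ G = WF G × M2≤ q G

  WF×M2≤-forest : ∀ acc Hs → ForestFrom F acc Hs → WF×M2≤ (⋃ acc) → WF×M2≤ (⋃ (acc ++ Hs))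
  WF×M2≤-forest acc [] _ inv = subst (WF×M2≤ ∘ ⋃) (sym (++-identityʳ acc)) inv
  WF×M2≤-forest acc (H ∷ Hs) (wfH , H≅F , attach , forest) (wfP , m2≤P) =
    subst (WF×M2≤ ∘ ⋃) (++-assoc acc (H ∷ []) Hs) (WF×M2≤-forest (acc ++ H ∷ []) Hs forest inv′)
    where
    m2≤H : M2≤ q H
    m2≤H = M2≤-embedding wfF (≅⇒Embedding H≅F) m2≤F
    inv′ : WF×M2≤ (⋃ (acc ++ H ∷ []))
    inv′ = subst WF×M2≤ (sym (⋃-∷ʳ acc H)) (WF-∪G wfP wfH , Gluing.M2≤-∪G wfP wfH 1≤q attach m2≤P m2≤H)

  M2≤-forestOfCopies : ∀ Hs → IsForestOfCopies F Hs → M2≤ q (⋃ Hs)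
  M2≤-forestOfCopies Hs forest = proj₂ (WF×M2≤-forest [] Hs forest ((λ ()) , M2≤-empty))

D2Attained-forestOfCopies : ∀ {F q} → D2Attained F q → ∀ Hs → Hs ≢ [] → IsForestOfCopies F Hs → D2Attained (⋃ Hs) q
D2Attained-forestOfCopies _ [] []≢[] _ = contradiction refl []≢[]
D2Attained-forestOfCopies attainedF (H ∷ _) _ (wfH , H≅F , _) =
  D2Attained-mono ∈-++⁺ˡ ∈-++⁺ˡ (D2Attained-embedding wfH (≅⇒Embedding (≅-sym H≅F)) attainedF)

proposition5p2 : (F : Graph) → WF F → 1 ≤ nE F →
    (Hs : List Graph) → Hs ≢ [] → IsForestOfCopies F Hs →
    (q : ℚ) → IsM2 F q → IsM2 (⋃ Hs) q
proposition5p2 F wfF 1≤eF Hs Hs≢[] forest q m2F@(attainedF , boundedF) =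
  D2Attained-forestOfCopies attainedF Hs Hs≢[] forest ,
  M2≤⇒D2Bounded 1≤q (M2≤-forestOfCopies 1≤q wfF (D2Bounded⇒M2≤ 1≤q boundedF) Hs forest)
  where
  1≤q : 1ℚ ≤ℚ q
  1≤q = IsM2⇒1≤ wfF 1≤eF m2F
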